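{- Let $n$ be a positive integer and let $L=(x_1,x_2,\ldots,x_n)$ be a list of length $n$ such that each $x_i$ is an odd positive integer not exceeding $n$. If $K_{2n}$ contains a perfect matching $F$ such that $\ell(F)=L$, then there exist $\varepsilon_1,\varepsilon_2,\ldots,\varepsilon_n\in\{ -1,1\}$ such that $\sum_{i=1}^n \varepsilon_i x_i\equiv n\pmod{2n}$.
   Context: For a positive integer $v$, $K_v$ denotes the complete graph on the vertex set $\{0,1,\ldots,v-1\}$. The length of an edge $\{u,w\}$ of $K_v$ is $\ell(u,w)=\min(|u-w|,\,v-|u-w|)$. For a subgraph $\Gamma$ of $K_v$, $\ell(\Gamma)$ is the list (multiset) of lengths of all edges of $\Gamma$, counted with multiplicity. A perfect matching of $K_{2n}$ is a set of $n$ pairwise disjoint edges covering all vertices. -}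

module Defs where

open import Data.Nat using (ℕ; _+_; _*_; _∸_; _≤_; _<_; _⊔_; _⊓_)
open import Data.Fin using (Fin; toℕ)
open import Data.Product using (Σ; _×_; _,_; proj₁; proj₂)
open import Data.List using (List; []; _∷_; map; length; concatMap)
open import Data.List.Membership.Propositional using (_∈_)
open import Data.List.Relation.Unary.Unique.Propositional using (Unique)
open import Data.List.Relation.Unary.All using (All)
open import Relation.Binary.PropositionalEquality using (_≡_)
open import Relation.Nullary using (¬_)

absDiff : ℕ → ℕ → ℕ
absDiff u w = (u ∸ w) + (w ∸ u)

edgeLength : (v : ℕ) → Fin v → Fin v → ℕ
edgeLength v u w = absDiff (toℕ u) (toℕ w) ⊓ (v ∸ absDiff (toℕ u) (toℕ w))

Edge : ℕ → Set
Edge v = Fin v × Fin v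

endpoints : {v : ℕ} → List (Edge v) → List (Fin v)
endpoints = concatMap (λ e → proj₁ e ∷ proj₂ e ∷ [])

lengths : (v : ℕ) → List (Edge v) → List ℕ
lengths v = map (λ e → edgeLength v (proj₁ e) (proj₂ e))

record IsPerfectMatching (n : ℕ) (F : List (Edge (2 * n))) : Set where
  field
    size     : length F ≡ n
    proper   : All (λ e → ¬ (proj₁ e ≡ proj₂ e)) F
    disjoint : Unique (endpoints F)
    covering : (x : Fin (2 * n)) → x ∈ endpoints F

Odd : ℕ → Set
Odd x = Σ ℕ λ k → x ≡ 1 + 2 * k

-- Give vertex v the weight (-1)^(v+1) v. The 2n vertices pair up as {2c, 2c+1}, each pair
-- of total weight 1, so the weights of all vertices sum to n. An edge of odd length in K_2n
-- joins vertices of opposite parity, so its two weights add up to ± their difference, which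
-- is congruent to ± the edge length modulo 2n. Summing over the edges of F expresses n, modulo 2n,
-- as a signed sum of the edge lengths, that is, of the entries of L.
module Submission where

open import Defs
open import Data.Nat as ℕ using (ℕ; zero; suc; _*_; _≤_; _<_; _∸_; _⊓_; ∣_-_∣)
import Data.Nat.Properties as ℕ
open import Data.Integer as ℤ using (ℤ; +_; 0ℤ; 1ℤ; _+_; _-_; -_)
import Data.Integer.Properties as ℤ
open import Data.Integer.Tactic.RingSolver using (solve-∀)
open import Data.Integer.Divisibility using (_∣_)
open import Data.Integer.Divisibility.Signed as Signed
  using (divides; ∣-refl; ∣m⇒∣-m; ∣m∣n⇒∣m+n; ∣⇒∣ᵤ)
open import Data.Sign as Sign using (Sign; opposite)
import Data.Sign.Properties as Sign
open import Data.Integer.Base using (_◃_)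
open import Data.Fin using (Fin; toℕ)
import Data.Fin.Properties as Fin
open import Data.Vec using (Vec; []; _∷_; lookup; toList)
open import Data.Vec.Functional as Vector using (foldr)
open import Data.Vec.Relation.Unary.All.Properties using (toList⁺; lookup⁻)
open import Data.List as List using (List; map; tabulate; allFin)
import Data.List.Properties as List
open import Data.List.Relation.Unary.All using (All; []; _∷_)
open import Data.List.Relation.Binary.Permutation.Propositional as ↭
  using (_↭_; ↭-sym; ↭⇒↭ₛ)
open import Data.List.Relation.Binary.Permutation.Propositional.Properties using (All-resp-↭; map⁺)
open import Data.List.Relation.Binary.Permutation.Setoid.Properties using (foldr-commMonoid)
open import Data.List.Relation.Binary.BagAndSetEquality using (∼bag⇒↭)
open import Data.List.Membership.Propositional.Properties using (∈-allFin)
open import Data.List.Membership.Propositional.Properties.WithK using (unique∧set⇒bag)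
open import Data.List.Relation.Unary.Unique.Propositional.Properties using (allFin⁺)
open import Algebra.Properties.CommutativeSemigroup ℤ.+-commutativeSemigroup using (x∙yz≈y∙xz)
open import Data.Product using (Σ; _×_; _,_; proj₁; proj₂)
open import Data.Sum using (inj₁; inj₂)
open import Function using (_∘_; mk⇔)
open import Relation.Binary.PropositionalEquality

parity : ℕ → Sign
parity zero    = Sign.+
parity (suc v) = opposite (parity v)

parity-+ : ∀ a b → parity (a ℕ.+ b) ≡ parity a Sign.* parity b
parity-+ zero    b = refl
parity-+ (suc a) b = trans (cong opposite (parity-+ a b)) (opposite-* (parity a))
  where
  opposite-* : ∀ s → opposite (s Sign.* parity b) ≡ opposite s Sign.* parity b
  opposite-* Sign.+ = refl
  opposite-* Sign.- = Sign.opposite-involutive (parity b)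

parity-*2 : ∀ c → parity (c * 2) ≡ Sign.+
parity-*2 zero    = refl
parity-*2 (suc c) = cong (opposite ∘ opposite) (parity-*2 c)

parity-2* : ∀ c → parity (2 * c) ≡ Sign.+
parity-2* c = trans (cong parity (ℕ.*-comm 2 c)) (parity-*2 c)

Odd⇒parity≡- : ∀ {x} → Odd x → parity x ≡ Sign.-
Odd⇒parity≡- (k , refl) = cong opposite (parity-2* k)

parity-+-odd : ∀ a {d} → parity d ≡ Sign.- → parity (a ℕ.+ d) ≡ opposite (parity a)
parity-+-odd a {d} odd =
  trans (parity-+ a d) (trans (cong (parity a Sign.*_) odd) (Sign.*-comm (parity a) Sign.-))

parity-∸ : ∀ {m d} → parity m ≡ Sign.+ → d ≤ m → parity (m ∸ d) ≡ parity d
parity-∸ {m} {d} even d≤m = Sign.*-cancelʳ-≡ (parity d) (parity (m ∸ d)) (parity d) (begin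
  parity (m ∸ d) Sign.* parity d  ≡⟨ parity-+ (m ∸ d) d ⟨
  parity (m ∸ d ℕ.+ d)            ≡⟨ cong parity (ℕ.m∸n+n≡m d≤m) ⟩
  parity m                        ≡⟨ even ⟩
  Sign.+                          ≡⟨ Sign.s*s≡+ (parity d) ⟨
  parity d Sign.* parity d        ∎)
  where open ≡-Reasoning

parity-⊓-∸ : ∀ {m d} → parity m ≡ Sign.+ → d ≤ m → parity (d ⊓ (m ∸ d)) ≡ parity d
parity-⊓-∸ {m} {d} even d≤m with ℕ.⊓-sel d (m ∸ d)
... | inj₁ eq = cong parity eq
... | inj₂ eq = trans (cong parity eq) (parity-∸ even d≤m)

infix 4 _≡_mod_

record _≡_mod_ (x y : ℤ) (m : ℕ) : Set where
  constructor ≡mod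
  field
    m∣x-y : + m Signed.∣ x - y

≡⇒≡mod : ∀ {m x y} → x ≡ y → x ≡ y mod m
≡⇒≡mod {x = x} refl = ≡mod (divides 0ℤ (ℤ.+-inverseʳ x))

≡mod-trans : ∀ {m x y z} → x ≡ y mod m → y ≡ z mod m → x ≡ z mod m
≡mod-trans {x = x} {y} {z} (≡mod p) (≡mod q) = ≡mod (subst (_ Signed.∣_) (telescope x y z) (∣m∣n⇒∣m+n p q))
  where
  telescope : ∀ x y z → (x - y) + (y - z) ≡ x - z
  telescope = solve-∀

+-cong-mod : ∀ {m x y u v} → x ≡ y mod m → u ≡ v mod m → x + u ≡ y + v mod m
+-cong-mod {x = x} {y} {u} {v} (≡mod p) (≡mod q) = ≡mod (subst (_ Signed.∣_) (interchange x y u v) (∣m∣n⇒∣m+n p q))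
  where
  interchange : ∀ x y u v → (x - y) + (u - v) ≡ (x + u) - (y + v)
  interchange = solve-∀

neg-◃ : ∀ s n → - (s ◃ n) ≡ opposite s ◃ n
neg-◃ Sign.+ n = trans (cong -_ (ℤ.+◃n≡+n n)) (sym (ℤ.-◃n≡-n n))
neg-◃ Sign.- n = trans (cong -_ (ℤ.-◃n≡-n n)) (trans (ℤ.neg-involutive (+ n)) (sym (ℤ.+◃n≡+n n)))

opposite◃n+s◃n≡0 : ∀ s n → (opposite s ◃ n) + (s ◃ n) ≡ 0ℤ
opposite◃n+s◃n≡0 s n = trans (cong (_+ (s ◃ n)) (sym (neg-◃ s n))) (ℤ.+-inverseˡ (s ◃ n))

n∣s◃n : ∀ s n → + n Signed.∣ s ◃ n
n∣s◃n Sign.+ n = subst (+ n Signed.∣_) (sym (ℤ.+◃n≡+n n)) ∣-refl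
n∣s◃n Sign.- n = subst (+ n Signed.∣_) (sym (ℤ.-◃n≡-n n)) (∣m⇒∣-m ∣-refl)

◃-∸-≡mod : ∀ s {m d} → d ≤ m → opposite s ◃ (m ∸ d) ≡ s ◃ d mod m
◃-∸-≡mod s {m} {d} d≤m = ≡mod (subst (+ m Signed.∣_) (sym difference) (n∣s◃n (opposite s) m))
  where
  open ≡-Reasoning
  difference : (opposite s ◃ (m ∸ d)) - (s ◃ d) ≡ opposite s ◃ m
  difference = begin
    (opposite s ◃ (m ∸ d)) - (s ◃ d)         ≡⟨ cong (λ t → (opposite s ◃ (m ∸ d)) + t) (neg-◃ s d) ⟩
    (opposite s ◃ (m ∸ d)) + (opposite s ◃ d) ≡⟨ ℤ.◃-distrib-+ (opposite s) (m ∸ d) d ⟨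
    opposite s ◃ (m ∸ d ℕ.+ d)               ≡⟨ cong (opposite s ◃_) (ℕ.m∸n+n≡m d≤m) ⟩
    opposite s ◃ m                           ∎

◃-⊓-∸-≡mod : ∀ s {m d} → d ≤ m → Σ Sign λ t → t ◃ (d ⊓ (m ∸ d)) ≡ s ◃ d mod m
◃-⊓-∸-≡mod s {m} {d} d≤m with ℕ.⊓-sel d (m ∸ d)
... | inj₁ eq = s , ≡⇒≡mod (cong (s ◃_) eq)
... | inj₂ eq = opposite s , subst (λ e → opposite s ◃ e ≡ s ◃ d mod m) (sym eq) (◃-∸-≡mod s d≤m)

weight : ℕ → ℤ
weight v = opposite (parity v) ◃ v

weight-pair : ∀ c → weight (c * 2) + weight (suc (c * 2)) ≡ 1ℤ
weight-pair c rewrite parity-*2 c = trans (cong (_+ + suc (c * 2)) (ℤ.-◃n≡-n (c * 2))) (cancel (+ (c * 2)))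
  where
  cancel : ∀ x → - x + (1ℤ + x) ≡ 1ℤ
  cancel = solve-∀

weight-+-odd : ∀ a {d} → parity d ≡ Sign.- → weight a + weight (a ℕ.+ d) ≡ parity a ◃ d
weight-+-odd a {d} odd = begin
  (opposite s ◃ a) + (opposite (parity (a ℕ.+ d)) ◃ (a ℕ.+ d))
    ≡⟨ cong (λ t → (opposite s ◃ a) + (opposite t ◃ (a ℕ.+ d))) (parity-+-odd a odd) ⟩
  (opposite s ◃ a) + (opposite (opposite s) ◃ (a ℕ.+ d))
    ≡⟨ cong (λ t → (opposite s ◃ a) + (t ◃ (a ℕ.+ d))) (Sign.opposite-involutive s) ⟩
  (opposite s ◃ a) + (s ◃ (a ℕ.+ d))
    ≡⟨ cong (λ t → (opposite s ◃ a) + t) (ℤ.◃-distrib-+ s a d) ⟩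
  (opposite s ◃ a) + ((s ◃ a) + (s ◃ d))
    ≡⟨ ℤ.+-assoc (opposite s ◃ a) (s ◃ a) (s ◃ d) ⟨
  ((opposite s ◃ a) + (s ◃ a)) + (s ◃ d)
    ≡⟨ cong (_+ (s ◃ d)) (opposite◃n+s◃n≡0 s a) ⟩
  0ℤ + (s ◃ d)
    ≡⟨ ℤ.+-identityˡ (s ◃ d) ⟩
  s ◃ d ∎
  where
  open ≡-Reasoning
  s : Sign
  s = parity a

weight-+-weight-≤ : ∀ {a b} → a ≤ b → parity ∣ a - b ∣ ≡ Sign.- →
                    Σ Sign λ s → weight a + weight b ≡ s ◃ ∣ a - b ∣
weight-+-weight-≤ {a} {b} a≤b odd rewrite ℕ.m≤n⇒∣m-n∣≡n∸m a≤b =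
  parity a , trans (cong (λ c → weight a + weight c) (sym (ℕ.m+[n∸m]≡n a≤b))) (weight-+-odd a odd)

weight-+-weight : ∀ a b → parity ∣ a - b ∣ ≡ Sign.- → Σ Sign λ s → weight a + weight b ≡ s ◃ ∣ a - b ∣
weight-+-weight a b odd with ℕ.≤-total a b
... | inj₁ a≤b = weight-+-weight-≤ a≤b odd
... | inj₂ b≤a with weight-+-weight-≤ b≤a (trans (cong parity (ℕ.∣-∣-comm b a)) odd)
...   | s , eq = s , trans (ℤ.+-comm (weight a) (weight b)) (trans eq (cong (s ◃_) (ℕ.∣-∣-comm b a)))

absDiff≡∣-∣ : ∀ a b → absDiff a b ≡ ∣ a - b ∣
absDiff≡∣-∣ zero    zero    = refl
absDiff≡∣-∣ zero    (suc b) = refl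
absDiff≡∣-∣ (suc a) zero    = ℕ.+-identityʳ (suc a)
absDiff≡∣-∣ (suc a) (suc b) = absDiff≡∣-∣ a b

vertexWeight : ∀ {m} → Fin m → ℤ
vertexWeight = weight ∘ toℕ

edgeWeight : ∀ {m} → Edge m → ℤ
edgeWeight e = vertexWeight (proj₁ e) + vertexWeight (proj₂ e)

signed-cyclicDistance-≡mod : ∀ {m a b} → parity m ≡ Sign.+ → a < m → b < m →
                       Odd (∣ a - b ∣ ⊓ (m ∸ ∣ a - b ∣)) →
                       Σ Sign λ t → t ◃ (∣ a - b ∣ ⊓ (m ∸ ∣ a - b ∣)) ≡ weight a + weight b mod m
signed-cyclicDistance-≡mod {m} {a} {b} even a<m b<m odd =
  let s , eq  = weight-+-weight a b (trans (sym (parity-⊓-∸ even d≤m)) (Odd⇒parity≡- odd))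
      t , eq′ = ◃-⊓-∸-≡mod s d≤m
  in t , ≡mod-trans eq′ (≡⇒≡mod (sym eq))
  where
  d≤m : ∣ a - b ∣ ≤ m
  d≤m = ℕ.≤-trans (ℕ.∣m-n∣≤m⊔n a b) (ℕ.⊔-lub (ℕ.<⇒≤ a<m) (ℕ.<⇒≤ b<m))

signed-edgeLength-≡mod : ∀ {m} → parity m ≡ Sign.+ → (e : Edge m) → Odd (edgeLength m (proj₁ e) (proj₂ e)) →
           Σ Sign λ t → t ◃ edgeLength m (proj₁ e) (proj₂ e) ≡ edgeWeight e mod m
signed-edgeLength-≡mod even (u , w) rewrite absDiff≡∣-∣ (toℕ u) (toℕ w) =
  signed-cyclicDistance-≡mod even (Fin.toℕ<n u) (Fin.toℕ<n w)

sumℤ : List ℤ → ℤ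
sumℤ = List.foldr _+_ 0ℤ

sumℤ-↭ : ∀ {xs ys} → xs ↭ ys → sumℤ xs ≡ sumℤ ys
sumℤ-↭ p = foldr-commMonoid (setoid ℤ) ℤ.+-0-isCommutativeMonoid (↭⇒↭ₛ p)

sumℤ-pairs : (h : ℕ → ℤ) → (∀ c → h (c * 2) + h (suc (c * 2)) ≡ 1ℤ) →
             ∀ n → sumℤ (tabulate {n = n * 2} (h ∘ toℕ)) ≡ + n
sumℤ-pairs h pair zero    = refl
sumℤ-pairs h pair (suc n) = begin
  h 0 + (h 1 + sumℤ (tabulate {n = n * 2} (h ∘ suc ∘ suc ∘ toℕ)))
    ≡⟨ ℤ.+-assoc (h 0) (h 1) _ ⟨
  (h 0 + h 1) + sumℤ (tabulate {n = n * 2} (h ∘ suc ∘ suc ∘ toℕ))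
    ≡⟨ cong₂ _+_ (pair 0) (sumℤ-pairs (h ∘ suc ∘ suc) (pair ∘ suc) n) ⟩
  1ℤ + + n ∎
  where open ≡-Reasoning

sumℤ-endpoints : ∀ {m} (g : Fin m → ℤ) (F : List (Edge m)) →
                 sumℤ (map g (endpoints F)) ≡ sumℤ (map (λ e → g (proj₁ e) + g (proj₂ e)) F)
sumℤ-endpoints g List.[]            = refl
sumℤ-endpoints g ((u , w) List.∷ F) =
  trans (cong (λ t → g u + (g w + t)) (sumℤ-endpoints g F)) (sym (ℤ.+-assoc (g u) (g w) _))

endpoints-↭-allFin : ∀ {n F} → IsPerfectMatching n F → endpoints F ↭ allFin (2 * n)
endpoints-↭-allFin pm = ∼bag⇒↭ (unique∧set⇒bag (IsPerfectMatching.disjoint pm) (allFin⁺ _)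
  (λ {x} → mk⇔ (λ _ → ∈-allFin x) (λ _ → IsPerfectMatching.covering pm x)))

perfectMatching-weight : ∀ {n F} → IsPerfectMatching n F → sumℤ (map edgeWeight F) ≡ + n
perfectMatching-weight {n} {F} pm = begin
  sumℤ (map edgeWeight F)
    ≡⟨ sumℤ-endpoints vertexWeight F ⟨
  sumℤ (map vertexWeight (endpoints F))
    ≡⟨ sumℤ-↭ (map⁺ vertexWeight (endpoints-↭-allFin pm)) ⟩
  sumℤ (map vertexWeight (allFin (2 * n)))
    ≡⟨ cong sumℤ (List.map-tabulate {n = 2 * n} (λ i → i) vertexWeight) ⟩
  sumℤ (tabulate {n = 2 * n} vertexWeight)
    ≡⟨ cong (λ k → sumℤ (tabulate {n = k} vertexWeight)) (ℕ.*-comm 2 n) ⟩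
  sumℤ (tabulate {n = n * 2} vertexWeight)
    ≡⟨ sumℤ-pairs weight weight-pair n ⟩
  + n ∎
  where open ≡-Reasoning

data SignedSum : List ℕ → ℤ → Set where
  []   : SignedSum List.[] 0ℤ
  _◃∷_ : ∀ {x xs z} (s : Sign) → SignedSum xs z → SignedSum (x List.∷ xs) ((s ◃ x) + z)

SignedSum-↭ : ∀ {xs ys z} → xs ↭ ys → SignedSum xs z → SignedSum ys z
SignedSum-↭ ↭.refl         p                = p
SignedSum-↭ (↭.prep x q)   (s ◃∷ p)         = s ◃∷ SignedSum-↭ q p
SignedSum-↭ (↭.swap x y q) (s ◃∷ (t ◃∷ p))  =
  subst (SignedSum _) (x∙yz≈y∙xz (t ◃ y) (s ◃ x) _) (t ◃∷ (s ◃∷ SignedSum-↭ q p))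
SignedSum-↭ (↭.trans q r)  p                = SignedSum-↭ r (SignedSum-↭ q p)

SignedSum⇒signs : ∀ {n} (L : Vec ℕ n) {z} → SignedSum (toList L) z →
                  Σ (Fin n → Sign) λ ε → foldr _+_ 0ℤ (λ i → ε i ◃ lookup L i) ≡ z
SignedSum⇒signs []      []       = (λ ()) , refl
SignedSum⇒signs (x ∷ L) (s ◃∷ p) =
  let ε , eq = SignedSum⇒signs L p in (s Vector.∷ ε) , cong (λ t → (s ◃ x) + t) eq

odd-lengths⇒SignedSum : ∀ {m} → parity m ≡ Sign.+ → (F : List (Edge m)) → All Odd (lengths m F) →
                        Σ ℤ λ z → SignedSum (lengths m F) z × z ≡ sumℤ (map edgeWeight F) mod m
odd-lengths⇒SignedSum even List.[]       []       = 0ℤ , [] , ≡⇒≡mod refl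
odd-lengths⇒SignedSum even (e List.∷ F) (o ∷ os) =
  let s , eq      = signed-edgeLength-≡mod even e o
      z , p , eq′ = odd-lengths⇒SignedSum even F os
  in _ , s ◃∷ p , +-cong-mod eq eq′

lemma3p8 : (n : ℕ) → 0 < n → (L : Vec ℕ n) →
           ((i : Fin n) → Odd (lookup L i) × 0 < lookup L i × lookup L i ≤ n) →
           (Σ (List (Edge (2 * n))) λ F → IsPerfectMatching n F × (lengths (2 * n) F ↭ toList L)) →
           Σ (Fin n → Sign) λ ε →
             (+ (2 * n)) ∣ (foldr ℤ._+_ (+ 0) (λ i → ε i ◃ lookup L i) ℤ.- + n)
lemma3p8 n _ L hL (F , pm , ℓF↭L) =
  let odd-lengths = All-resp-↭ (↭-sym ℓF↭L) (toList⁺ (lookup⁻ (proj₁ ∘ hL)))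
      z , p , z≡  = odd-lengths⇒SignedSum (parity-2* n) F odd-lengths
      ε , Σε≡z    = SignedSum⇒signs L (SignedSum-↭ ℓF↭L p)
  in ε , ∣⇒∣ᵤ (_≡_mod_.m∣x-y (subst₂ (λ x y → x ≡ y mod 2 * n) (sym Σε≡z) (perfectMatching-weight pm) z≡))
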